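{- Let $G_1$ be a $p$-vertex-critical graph, let $S$ be a homogeneous set of $G_1$ with $\chi(G_1[S])=q$, and let $G_2$ be a $q$-vertex-critical graph whose vertex set is disjoint from $V(G_1)$. Let $G$ be the graph obtained from $G_1$ by substituting $G_2$ for $S$. Then $G$ is $p$-vertex-critical.
   Context: All graphs are finite and simple. A graph $H$ is $k$-vertex-critical if $\chi(H)=k$ and every proper induced subgraph of $H$ has chromatic number less than $k$. A set $S\subseteq V(G_1)$ is homogeneous if every vertex of $V(G_1)\setminus S$ is adjacent to all vertices of $S$ or to none of them. The graph $G$ obtained from $G_1$ by substituting $G_2$ for $S$ has vertex set $(V(G_1)\setminus S)\cup V(G_2)$; two vertices of $V(G_1)\setminus S$ are adjacent in $G$ iff adjacent in $G_1$; two vertices of $V(G_2)$ are adjacent in $G$ iff adjacent in $G_2$; and $u\in V(G_1)\setminus S$, $v\in V(G_2)$ are adjacent in $G$ iff $u$ is adjacent in $G_1$ to every vertex of $S$. -}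

module Defs where

open import Level using (Level; 0ℓ)
open import Data.Nat using (ℕ; _<_)
open import Data.Fin using (Fin)
open import Data.Bool using (Bool; true; false)
open import Data.Product using (Σ; Σ-syntax; ∃; ∃-syntax; _×_; _,_; proj₁)
open import Data.Sum using (_⊎_; inj₁; inj₂)
open import Data.Empty using (⊥)
open import Relation.Nullary using (¬_)
open import Relation.Binary.PropositionalEquality using (_≡_; _≢_)
open import Function.Bundles using (_↔_)

record Graph : Set₁ where
  field
    V      : Set
    Adj    : V → V → Set
    sym    : ∀ {u v} → Adj u v → Adj v u
    irrefl : ∀ {v} → ¬ Adj v v
open Graph public

Finite : Graph → Set
Finite G = ∃[ n ] (V G ↔ Fin n)

Colourable : Graph → ℕ → Set
Colourable G k = Σ[ c ∈ (V G → Fin k) ] (∀ u v → Adj G u v → c u ≢ c v)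

ChromaticNumber : Graph → ℕ → Set
ChromaticNumber G k = Colourable G k × (∀ m → m < k → ¬ Colourable G m)

Induced : (G : Graph) → (V G → Bool) → Graph
Induced G P = record
  { V      = Σ[ v ∈ V G ] (P v ≡ true)
  ; Adj    = λ u v → Adj G (proj₁ u) (proj₁ v)
  ; sym    = sym G
  ; irrefl = irrefl G
  }

VertexCritical : ℕ → Graph → Set
VertexCritical k H =
  ChromaticNumber H k ×
  (∀ (P : V H → Bool) → (∃[ v ] (P v ≡ false)) →
     ∃[ m ] (ChromaticNumber (Induced H P) m × m < k))

Homogeneous : (G : Graph) → (V G → Bool) → Set
Homogeneous G S =
  ∀ u → S u ≡ false →
    (∀ s → S s ≡ true → Adj G u s) ⊎ (∀ s → S s ≡ true → ¬ Adj G u s)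

-- Substitution of G₂ for S in G₁.  Vertex set is the disjoint union
-- (V(G₁) \ S) ⊎ V(G₂), so disjointness of vertex sets is built in.
module _ (G₁ : Graph) (S : V G₁ → Bool) (G₂ : Graph) where
  private
    Out = Σ[ v ∈ V G₁ ] (S v ≡ false)
    Full : V G₁ → Set
    Full u = ∀ s → S s ≡ true → Adj G₁ u s

    SAdj : (Out ⊎ V G₂) → (Out ⊎ V G₂) → Set
    SAdj (inj₁ a) (inj₁ b) = Adj G₁ (proj₁ a) (proj₁ b)
    SAdj (inj₁ a) (inj₂ y) = Full (proj₁ a)
    SAdj (inj₂ x) (inj₁ b) = Full (proj₁ b)
    SAdj (inj₂ x) (inj₂ y) = Adj G₂ x y

    SSym : ∀ {u v} → SAdj u v → SAdj v u
    SSym {inj₁ a} {inj₁ b} e = sym G₁ e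
    SSym {inj₁ a} {inj₂ y} e = e
    SSym {inj₂ x} {inj₁ b} e = e
    SSym {inj₂ x} {inj₂ y} e = sym G₂ e

    SIrr : ∀ {v} → ¬ SAdj v v
    SIrr {inj₁ a} = irrefl G₁
    SIrr {inj₂ x} = irrefl G₂

  Substitute : Graph
  Substitute = record { V = Out ⊎ V G₂ ; Adj = SAdj ; sym = λ {u} {v} → SSym {u} {v} ; irrefl = λ {v} → SIrr {v} }

-- Colourings move across a substitution: if c colours H and Z maps into the
-- part S of H, then c uses at least χ(Z) colours on Z, so any Y with
-- χ(Y) ≤ χ(Z) can be coloured injectively into those colours; a vertex
-- adjacent to Y is adjacent to all of S and so sees none of them.  Hence H
-- with Y substituted for S is coloured by as many colours as H.  With
-- Z = G₁[S] and Y = G₂ this p-colours G; with Z = G₂ and Y = G₁[S],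
-- homogeneity turns a colouring of G into one of G₁, so χ(G) = p.  After
-- deleting a vertex outside S, colour G₁ minus that vertex with fewer than p
-- colours and substitute G₂; after deleting a vertex of G₂, colour G₁ minus
-- some s₀ ∈ S and substitute the rest of G₂, whose chromatic number is below
-- q ≤ χ(G₁[S] − s₀) + 1.  Constructively, the chromatic number of what remains
-- is then found by exhaustive search, which needs decidable non-adjacency;
-- criticality of G₁ and G₂ supplies it.
{-# OPTIONS --safe #-}
module Submission where

open import Defs
open import Axiom.UniquenessOfIdentityProofs using (module Decidable⇒UIP)
open import Data.Bool as Bool using (Bool; true; false; _∨_)
open import Data.Bool.Properties using (∨-zeroʳ; ¬-not)
open import Data.Empty using (⊥-elim)
open import Data.Fin as Fin using (Fin; zero; suc; inject≤; inject₁; fromℕ)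
open import Data.Fin.Properties using (all?; inject≤-injective; inject₁-injective; fromℕ≢inject₁; inj⇒≟)
open import Data.List using (List; []; [_]; map; _++_; concatMap; allFin; filter; lookup; length)
open import Data.List.Membership.Propositional using (_∈_; lose)
open import Data.List.Membership.Propositional.Properties
  using (∈-map⁺; ∈-++⁺ˡ; ∈-++⁺ʳ; ∈-concatMap⁺; ∈-allFin; ∈-filter⁺; ∈-filter⁻; ∈-lookup)
import Data.List.Relation.Unary.All as All
open import Data.List.Relation.Unary.Any using (here; any?; satisfied; index)
open import Data.List.Relation.Unary.Any.Properties using (lookup-index)
open import Data.List.Relation.Unary.Unique.Propositional using (Unique; _∷_)
open import Data.List.Relation.Unary.Unique.Propositional.Properties using (allFin⁺; filter⁺)
open import Data.Nat using (ℕ; zero; suc; _≤_; _<_; z≤n; _≤?_)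
open import Data.Nat.Properties using (≮⇒≥; ≰⇒>; ≤-<-trans; <-≤-trans; ≤-pred; ≤-refl; m≤n⇒m≤1+n)
open import Data.Product using (Σ; Σ-syntax; ∃; ∃-syntax; _×_; _,_; proj₁; proj₂)
open import Data.Sum using (_⊎_; inj₁; inj₂)
open import Data.Vec using (Vec; []; _∷_; tabulate) renaming (lookup to lookupᵥ)
open import Data.Vec.Properties using (lookup∘tabulate)
open import Function using (_∘_; _↔_; Inverse)
open import Function.Properties.Inverse using (↔⇒↣)
open import Level using (0ℓ)
open import Relation.Binary.Definitions using (DecidableEquality)
open import Relation.Binary.PropositionalEquality
  using (_≡_; _≢_; refl; trans; cong; subst; subst₂) renaming (sym to ≡-sym)
open import Relation.Nullary using (¬_; Dec; yes; no; does; map′; contradiction)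
open import Relation.Nullary.Decidable using (dec-true; dec-false)
open import Relation.Unary using (Pred; Decidable)

private
  variable
    A B : Set
    k m n q r : ℕ
    H H′ : Graph

-- Enumerable types

-- A covering list, rather than a bijection with some Fin n, so that subtypes
-- are enumerable without counting them.
Enumerable : Set → Set
Enumerable A = Σ[ xs ∈ List A ] (∀ a → a ∈ xs)

Enumerable-Fin : ∀ k → Enumerable (Fin k)
Enumerable-Fin k = allFin k , ∈-allFin

Enumerable-↔ : A ↔ Fin n → Enumerable A
Enumerable-↔ {n = n} A↔Fin = map from (allFin n) , complete
  where
  open Inverse A↔Fin
  complete : ∀ a → a ∈ map from (allFin n)
  complete a = subst (_∈ map from (allFin n)) (strictlyInverseʳ a) (∈-map⁺ from (∈-allFin (to a)))

Enumerable-⊎ : Enumerable A → Enumerable B → Enumerable (A ⊎ B)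
Enumerable-⊎ (xs , xs-complete) (ys , ys-complete) = map inj₁ xs ++ map inj₂ ys , complete
  where
  complete : ∀ x → x ∈ map inj₁ xs ++ map inj₂ ys
  complete (inj₁ a) = ∈-++⁺ˡ (∈-map⁺ inj₁ (xs-complete a))
  complete (inj₂ b) = ∈-++⁺ʳ (map inj₁ xs) (∈-map⁺ inj₂ (ys-complete b))

Enumerable-Σ : {B : A → Set} → Enumerable A → (∀ a → Enumerable (B a)) → Enumerable (Σ A B)
Enumerable-Σ {A = A} {B = B} (xs , xs-complete) E = concatMap fibre xs , complete
  where
  fibre : A → List (Σ A B)
  fibre a = map (a ,_) (proj₁ (E a))
  complete : ∀ x → x ∈ concatMap fibre xs
  complete (a , b) = ∈-concatMap⁺ fibre (lose (xs-complete a) (∈-map⁺ (a ,_) (proj₂ (E a) b)))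

Enumerable-≡ : DecidableEquality A → (x y : A) → Enumerable (x ≡ y)
Enumerable-≡ _≟_ x y with x ≟ y
... | yes x≡y = [ x≡y ] , λ p → here (Decidable⇒UIP.≡-irrelevant _≟_ p x≡y)
... | no x≢y  = [] , λ p → contradiction p x≢y

Enumerable-subset : Enumerable A → (P : A → Bool) (b : Bool) → Enumerable (Σ[ a ∈ A ] P a ≡ b)
Enumerable-subset E P b = Enumerable-Σ E (λ a → Enumerable-≡ Bool._≟_ (P a) b)

∃? : {P : Pred A 0ℓ} → Enumerable A → Decidable P → Dec (∃ P)
∃? (xs , xs-complete) P? = map′ satisfied (λ (a , pa) → lose (xs-complete a) pa) (any? P? xs)

∃-Vec? : Enumerable A → ∀ n {P : Pred (Vec A n) 0ℓ} → Decidable P → Dec (∃ P)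
∃-Vec? E zero    P? = map′ ([] ,_) (λ { ([] , p) → p }) (P? [])
∃-Vec? E (suc n) P? =
  map′ (λ (a , v , p) → a ∷ v , p) (λ { (a ∷ v , p) → a , v , p })
       (∃? E (λ a → ∃-Vec? E n (λ v → P? (a ∷ v))))

lookup-injective : {xs : List A} → Unique xs → ∀ i j → lookup xs i ≡ lookup xs j → i ≡ j
lookup-injective (x∉xs ∷ u) zero    zero    eq = refl
lookup-injective (x∉xs ∷ u) zero    (suc j) eq = contradiction eq (All.lookup x∉xs (∈-lookup j))
lookup-injective (x∉xs ∷ u) (suc i) zero    eq = contradiction (≡-sym eq) (All.lookup x∉xs (∈-lookup i))
lookup-injective (x∉xs ∷ u) (suc i) (suc j) eq = cong suc (lookup-injective u i j eq)

module _ (_≟_ : DecidableEquality A) where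

  others : A → A → Bool
  others a x = Bool.not (does (x ≟ a))

  others-self : ∀ a → others a a ≡ false
  others-self a = cong Bool.not (dec-true (a ≟ a) refl)

  others-≢ : ∀ {a x} → x ≢ a → others a x ≡ true
  others-≢ {a} {x} x≢a = cong Bool.not (dec-false (x ≟ a) x≢a)

  others-false : ∀ {a x} → others a x ≡ false → x ≡ a
  others-false {a} {x} eq with x ≟ a
  ... | yes x≡a = x≡a

-- Colourings and homomorphisms

Proper : (H : Graph) → (V H → Fin k) → Set
Proper H c = ∀ u v → Adj H u v → c u ≢ c v

_≤χ_ : ℕ → Graph → Set
r ≤χ H = ∀ m → Colourable H m → r ≤ m

ChromaticNumber⇒≤χ : ChromaticNumber H k → k ≤χ H
ChromaticNumber⇒≤χ (_ , minimal) m colourable = ≮⇒≥ (λ m<k → minimal m m<k colourable)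

Colourable-mono : m ≤ n → Colourable H m → Colourable H n
Colourable-mono m≤n (c , proper) =
  (λ v → inject≤ (c v) m≤n) , λ u v adj eq → proper u v adj (inject≤-injective m≤n m≤n _ _ eq)

ChromaticNumber⇒Colourable? : ChromaticNumber H k → ∀ m → Dec (Colourable H m)
ChromaticNumber⇒Colourable? {H = H} {k = k} (colourable , minimal) m with k ≤? m
... | yes k≤m = yes (Colourable-mono {H = H} k≤m colourable)
... | no k≰m  = no (minimal m (≰⇒> k≰m))

Colourable-extendIndependent : (R : V H → Bool) → (∀ u v → R u ≡ false → R v ≡ false → ¬ Adj H u v) →
                               Colourable (Induced H R) m → Colourable H (suc m)
Colourable-extendIndependent {H = H} {m = m} R independent (c , proper) =
  (λ u → colour u (R u) refl) , λ u v → proper′ u v (R u) (R v) refl refl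
  where
  colour : (u : V H) (b : Bool) → R u ≡ b → Fin (suc m)
  colour u true  Ru = inject₁ (c (u , Ru))
  colour u false _  = fromℕ m
  proper′ : ∀ u v bu bv (Ru : R u ≡ bu) (Rv : R v ≡ bv) → Adj H u v → colour u bu Ru ≢ colour v bv Rv
  proper′ u v true  true  Ru Rv adj eq = proper _ _ adj (inject₁-injective eq)
  proper′ u v true  false Ru Rv adj eq = fromℕ≢inject₁ (≡-sym eq)
  proper′ u v false true  Ru Rv adj eq = fromℕ≢inject₁ eq
  proper′ u v false false Ru Rv adj eq = independent u v Ru Rv adj

record _⇒_ (H H′ : Graph) : Set where
  field
    vertex : V H → V H′
    edge   : ∀ {u v} → Adj H u v → Adj H′ (vertex u) (vertex v)
open _⇒_

Colourable-⇒ : H ⇒ H′ → Colourable H′ k → Colourable H k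
Colourable-⇒ f (c , proper) = c ∘ vertex f , λ u v adj → proper _ _ (edge f adj)

Induced⇒ : (P : V H → Bool) → Induced H P ⇒ H
Induced⇒ P = record { vertex = proj₁ ; edge = λ adj → adj }

ChromaticNumber-⇔ : H ⇒ H′ → H′ ⇒ H → ChromaticNumber H k → ChromaticNumber H′ k
ChromaticNumber-⇔ f g (colourable , minimal) =
  Colourable-⇒ g colourable , λ m m<k → minimal m m<k ∘ Colourable-⇒ f

-- Computing chromatic numbers

DecNonAdj : Graph → Set
DecNonAdj H = ∀ u v → Dec (¬ Adj H u v)

DecNonAdj-Induced : (P : V H → Bool) → DecNonAdj H → DecNonAdj (Induced H P)
DecNonAdj-Induced P nonAdj? u v = nonAdj? (proj₁ u) (proj₁ v)

Colourable? : Enumerable (V H) → DecNonAdj H → ∀ k → Dec (Colourable H k)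
Colourable? {H = H} (xs , xs-complete) nonAdj? k =
  map′ fromVec toVec (∃-Vec? (Enumerable-Fin k) (length xs) λ g → all? λ i → all? λ j → proper? g i j)
  where
  ProperVec : Vec (Fin k) (length xs) → Set
  ProperVec g = ∀ i j → Adj H (lookup xs i) (lookup xs j) → lookupᵥ g i ≢ lookupᵥ g j
  proper? : ∀ g i j → Dec (Adj H (lookup xs i) (lookup xs j) → lookupᵥ g i ≢ lookupᵥ g j)
  proper? g i j with nonAdj? (lookup xs i) (lookup xs j) | lookupᵥ g i Fin.≟ lookupᵥ g j
  ... | yes nonAdj | _      = yes λ adj → contradiction adj nonAdj
  ... | no ¬nonAdj | yes eq = no λ proper → ¬nonAdj λ adj → proper adj eq
  ... | no _       | no neq = yes λ _ → neq
  fromVec : ∃ ProperVec → Colourable H k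
  fromVec (g , proper) = (λ a → lookupᵥ g (index (xs-complete a))) , λ u v adj →
    proper _ _ (subst₂ (Adj H) (lookup-index (xs-complete u)) (lookup-index (xs-complete v)) adj)
  toVec : Colourable H k → ∃ ProperVec
  toVec (c , proper) = tabulate (c ∘ lookup xs) , λ i j adj →
    subst₂ _≢_ (≡-sym (lookup∘tabulate _ i)) (≡-sym (lookup∘tabulate _ j)) (proper _ _ adj)

Colourable⇒ChromaticNumber≤ : Enumerable (V H) → DecNonAdj H → Colourable H k →
                              ∃[ m ] ChromaticNumber H m × m ≤ k
Colourable⇒ChromaticNumber≤ {k = zero} E nonAdj? colourable = 0 , (colourable , λ _ ()) , z≤n
Colourable⇒ChromaticNumber≤ {H = H} {k = suc k} E nonAdj? colourable with Colourable? {H = H} E nonAdj? k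
... | yes colourable-k =
  let m , χ , m≤k = Colourable⇒ChromaticNumber≤ {H = H} E nonAdj? colourable-k in m , χ , m≤n⇒m≤1+n m≤k
... | no ¬colourable-k =
  suc k , (colourable , λ m m<1+k → ¬colourable-k ∘ Colourable-mono {H = H} (≤-pred m<1+k)) , ≤-refl

VertexCritical⇒ChromaticNumber-Induced : Enumerable (V H) → VertexCritical k H → (P : V H → Bool) →
                                         ∃[ m ] ChromaticNumber (Induced H P) m
VertexCritical⇒ChromaticNumber-Induced {H = H} E (χH , critical) P with ∃? E (λ v → P v Bool.≟ false)
... | yes deleted = let m , χ , _ = critical P deleted in m , χ
... | no ¬deleted = _ , ChromaticNumber-⇔ {H = H} total (Induced⇒ P) χH
  where
  total : H ⇒ Induced H P
  total = record { vertex = λ v → v , ¬-not (λ Pv≡false → ¬deleted (v , Pv≡false)) ; edge = λ adj → adj }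

-- Criticality gives H[{u, v}] a chromatic number, which decides whether it is
-- 1-colourable, that is, whether u and v are non-adjacent.
VertexCritical⇒DecNonAdj : Enumerable (V H) → DecidableEquality (V H) → VertexCritical k H → DecNonAdj H
VertexCritical⇒DecNonAdj {H = H} E _≟_ critical u v =
  map′ colourable⇒nonAdj nonAdj⇒colourable (ChromaticNumber⇒Colourable? {H = Induced H pair} χ-pair 1)
  where
  pair : V H → Bool
  pair w = does (w ≟ u) ∨ does (w ≟ v)
  χ-pair : ChromaticNumber (Induced H pair) _
  χ-pair = proj₂ (VertexCritical⇒ChromaticNumber-Induced {H = H} E critical pair)
  u∈pair : pair u ≡ true
  u∈pair = cong (_∨ does (u ≟ v)) (dec-true (u ≟ u) refl)
  v∈pair : pair v ≡ true
  v∈pair = trans (cong (does (v ≟ u) ∨_) (dec-true (v ≟ v) refl)) (∨-zeroʳ _)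
  pair-cases : ∀ {w} → pair w ≡ true → w ≡ u ⊎ w ≡ v
  pair-cases {w} eq with w ≟ u | w ≟ v
  ... | yes w≡u | _       = inj₁ w≡u
  ... | no _    | yes w≡v = inj₂ w≡v
  one-colour : (i j : Fin 1) → i ≡ j
  one-colour zero zero = refl
  colourable⇒nonAdj : Colourable (Induced H pair) 1 → ¬ Adj H u v
  colourable⇒nonAdj (c , proper) adj = proper (u , u∈pair) (v , v∈pair) adj (one-colour _ _)
  no-edge : ¬ Adj H u v → ∀ {w w′} → w ≡ u ⊎ w ≡ v → w′ ≡ u ⊎ w′ ≡ v → ¬ Adj H w w′
  no-edge nonAdj (inj₁ refl) (inj₁ refl) = irrefl H
  no-edge nonAdj (inj₁ refl) (inj₂ refl) = nonAdj
  no-edge nonAdj (inj₂ refl) (inj₁ refl) = nonAdj ∘ sym H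
  no-edge nonAdj (inj₂ refl) (inj₂ refl) = irrefl H
  nonAdj⇒colourable : ¬ Adj H u v → Colourable (Induced H pair) 1
  nonAdj⇒colourable nonAdj = (λ _ → zero) , λ (w , pw) (w′ , pw′) adj _ →
    no-edge nonAdj (pair-cases pw) (pair-cases pw′) adj

-- Substitution

-- The colours c uses, listed without repetition, are at least χ(Z) ≥ r many,
-- so the r colours of Y can be sent injectively into them.
recolour-into-image : {Z Y : Graph} → Enumerable (V Z) → (c : V Z → Fin k) → Proper Z c →
                      r ≤χ Z → Colourable Y r →
                      Σ[ φ ∈ (V Y → Fin k) ] Proper Y φ × (∀ y → ∃ λ z → c z ≡ φ y)
recolour-into-image {k = k} {r = r} {Z = Z} {Y = Y} EZ c c-proper r≤χZ (d , d-proper) = φ , φ-proper , φ-used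
  where
  used? : Decidable (λ i → ∃ λ z → c z ≡ i)
  used? i = ∃? EZ (λ z → c z Fin.≟ i)
  used : List (Fin k)
  used = filter used? (allFin k)
  rank : V Z → Fin (length used)
  rank z = index (∈-filter⁺ used? (∈-allFin (c z)) (z , refl))
  rank-correct : ∀ z → c z ≡ lookup used (rank z)
  rank-correct z = lookup-index (∈-filter⁺ used? (∈-allFin (c z)) (z , refl))
  r≤#used : r ≤ length used
  r≤#used = r≤χZ _ (rank , λ u v adj eq →
    c-proper u v adj (trans (rank-correct u) (trans (cong (lookup used) eq) (≡-sym (rank-correct v)))))
  φ : V Y → Fin k
  φ y = lookup used (inject≤ (d y) r≤#used)
  φ-proper : Proper Y φ
  φ-proper x y adj eq =
    d-proper x y adj (inject≤-injective _ _ _ _ (lookup-injective (filter⁺ used? (allFin⁺ k)) _ _ eq))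
  φ-used : ∀ y → ∃ λ z → c z ≡ φ y
  φ-used y = proj₂ (∈-filter⁻ used? {xs = allFin k} (∈-lookup _))

AdjacentToAll : (H : Graph) → (V H → Bool) → V H → Set
AdjacentToAll H S a = ∀ s → S s ≡ true → Adj H a s

Colourable-Substitute : {Z Y : Graph} (S : V H → Bool) → Enumerable (V Z) → (ζ : Z ⇒ H) →
                        (∀ z → S (vertex ζ z) ≡ true) → r ≤χ Z → Colourable Y r →
                        Colourable H k → Colourable (Substitute H S Y) k
Colourable-Substitute {H = H} {k = k} {Z = Z} {Y = Y} S EZ ζ ζ∈S r≤χZ colourable-Y (c , c-proper)
  with recolour-into-image {Z = Z} {Y = Y} EZ (c ∘ vertex ζ) (λ u v adj → c-proper _ _ (edge ζ adj))
                           r≤χZ colourable-Y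
... | φ , φ-proper , φ-used = colour , proper
  where
  colour : V (Substitute H S Y) → Fin k
  colour (inj₁ a) = c (proj₁ a)
  colour (inj₂ y) = φ y
  across : ∀ a y → AdjacentToAll H S a → c a ≢ φ y
  across a y full eq = let z , cζz≡φy = φ-used y in
    c-proper _ _ (full _ (ζ∈S z)) (trans eq (≡-sym cζz≡φy))
  proper : Proper (Substitute H S Y) colour
  proper (inj₁ a) (inj₁ b) adj  = c-proper _ _ adj
  proper (inj₁ a) (inj₂ y) full = across (proj₁ a) y full
  proper (inj₂ y) (inj₁ a) full = across (proj₁ a) y full ∘ ≡-sym
  proper (inj₂ x) (inj₂ y) adj  = φ-proper x y adj

module Substitution (G₁ : Graph) (S : V G₁ → Bool) (G₂ : Graph) where

  private
    G : Graph
    G = Substitute G₁ S G₂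

  inside : V G → Bool
  inside (inj₁ _) = false
  inside (inj₂ _) = true

  Enumerable-Substitute : Enumerable (V G₁) → Enumerable (V G₂) → Enumerable (V G)
  Enumerable-Substitute E₁ E₂ = Enumerable-⊎ (Enumerable-subset E₁ S false) E₂

  DecNonAdj-Substitute : Homogeneous G₁ S → Enumerable (V G₁) → DecNonAdj G₁ → DecNonAdj G₂ → DecNonAdj G
  DecNonAdj-Substitute homogeneous E₁ nonAdj₁? nonAdj₂? = nonAdj?
    where
    nonFull? : ∀ a → S a ≡ false → Dec (¬ AdjacentToAll G₁ S a)
    nonFull? a Sa with homogeneous a Sa | ∃? E₁ (λ s → S s Bool.≟ true)
    ... | inj₁ full | _             = no λ ¬full → ¬full full
    ... | inj₂ none | yes (s , Ss)  = yes λ full → none s Ss (full s Ss)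
    ... | inj₂ none | no ¬inhabited = no λ ¬full → ¬full λ s Ss → contradiction (s , Ss) ¬inhabited
    nonAdj? : DecNonAdj G
    nonAdj? (inj₁ a)        (inj₁ b)        = nonAdj₁? (proj₁ a) (proj₁ b)
    nonAdj? (inj₁ (a , Sa)) (inj₂ y)        = nonFull? a Sa
    nonAdj? (inj₂ y)        (inj₁ (a , Sa)) = nonFull? a Sa
    nonAdj? (inj₂ x)        (inj₂ y)        = nonAdj₂? x y

  Colourable-Substitute⁺ : Enumerable (V G₁) → q ≤χ Induced G₁ S → Colourable G₂ q →
                           Colourable G₁ k → Colourable G k
  Colourable-Substitute⁺ E₁ = Colourable-Substitute S (Enumerable-subset E₁ S true) (Induced⇒ S) proj₂

  -- By homogeneity, G₁ maps into G with G₁[S] substituted back for G₂.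
  Colourable-Substitute⁻ : Homogeneous G₁ S → Enumerable (V G₂) → q ≤χ G₂ →
                           Colourable (Induced G₁ S) q → Colourable G k → Colourable G₁ k
  Colourable-Substitute⁻ homogeneous E₂ q≤χG₂ colourable-S colourable-G =
    Colourable-⇒ {H′ = T} fold
      (Colourable-Substitute inside E₂ embed₂ (λ _ → refl) q≤χG₂ colourable-S colourable-G)
    where
    T : Graph
    T = Substitute G inside (Induced G₁ S)
    embed₂ : G₂ ⇒ G
    embed₂ = record { vertex = inj₂ ; edge = λ adj → adj }
    place : (a : V G₁) (b : Bool) → S a ≡ b → V T
    place a true  Sa = inj₂ (a , Sa)
    place a false Sa = inj₁ (inj₁ (a , Sa) , refl)
    outside-inside : ∀ u v Su Sv → Adj G₁ u v → Adj T (place u false Su) (place v true Sv)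
    outside-inside u v Su Sv adj with homogeneous u Su
    ... | inj₁ full = λ { (inj₁ _) () ; (inj₂ _) _ → full }
    ... | inj₂ none = contradiction adj (none v Sv)
    place-edge : ∀ u v bu bv (Su : S u ≡ bu) (Sv : S v ≡ bv) → Adj G₁ u v → Adj T (place u bu Su) (place v bv Sv)
    place-edge u v true  true  Su Sv adj = adj
    place-edge u v false false Su Sv adj = adj
    place-edge u v false true  Su Sv adj = outside-inside u v Su Sv adj
    place-edge u v true  false Su Sv adj =
      sym T {place v false Sv} {place u true Su} (outside-inside v u Sv Su (sym G₁ adj))
    fold : G₁ ⇒ T
    fold = record { vertex = λ a → place a (S a) refl ; edge = λ {u} {v} → place-edge u v (S u) (S v) refl refl }

  Induced-Substitute⇒ : (P : V G → Bool) (Q : V G₁ → Bool) (R : V G₂ → Bool) →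
                        (∀ a → P (inj₁ a) ≡ true → Q (proj₁ a) ≡ true) →
                        (∀ y → P (inj₂ y) ≡ true → R y ≡ true) →
                        Induced G P ⇒ Substitute (Induced G₁ Q) (S ∘ proj₁) (Induced G₂ R)
  Induced-Substitute⇒ P Q R P⇒Q P⇒R = record { vertex = restrict ; edge = λ {u} {v} → restrict-edge u v }
    where
    T : Graph
    T = Substitute (Induced G₁ Q) (S ∘ proj₁) (Induced G₂ R)
    restrict : V (Induced G P) → V T
    restrict (inj₁ a , Pa) = inj₁ ((proj₁ a , P⇒Q a Pa) , proj₂ a)
    restrict (inj₂ y , Py) = inj₂ (y , P⇒R y Py)
    restrict-edge : ∀ u v → Adj (Induced G P) u v → Adj T (restrict u) (restrict v)
    restrict-edge (inj₁ _ , _) (inj₁ _ , _) adj  = adj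
    restrict-edge (inj₁ _ , _) (inj₂ _ , _) full = full ∘ proj₁
    restrict-edge (inj₂ _ , _) (inj₁ _ , _) full = full ∘ proj₁
    restrict-edge (inj₂ _ , _) (inj₂ _ , _) adj  = adj

  Colourable-Induced-Substitute : Enumerable (V G₁) → (P : V G → Bool) (Q : V G₁ → Bool) (R : V G₂ → Bool) →
                                  (∀ a → P (inj₁ a) ≡ true → Q (proj₁ a) ≡ true) →
                                  (∀ y → P (inj₂ y) ≡ true → R y ≡ true) →
                                  r ≤χ Induced (Induced G₁ S) (Q ∘ proj₁) → Colourable (Induced G₂ R) r →
                                  Colourable (Induced G₁ Q) k → Colourable (Induced G P) k
  Colourable-Induced-Substitute E₁ P Q R P⇒Q P⇒R r≤χ colourable-R colourable-Q =
    Colourable-⇒ (Induced-Substitute⇒ P Q R P⇒Q P⇒R)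
      (Colourable-Substitute (S ∘ proj₁) (Enumerable-subset (Enumerable-subset E₁ S true) (Q ∘ proj₁) true)
                             ζ (proj₂ ∘ proj₁) r≤χ colourable-R colourable-Q)
    where
    ζ : Induced (Induced G₁ S) (Q ∘ proj₁) ⇒ Induced G₁ Q
    ζ = record { vertex = λ ((v , _) , Qv) → v , Qv ; edge = λ adj → adj }

module CriticalSubstitution {p q : ℕ} {G₁ G₂ : Graph} {S : V G₁ → Bool}
  (fin₁ : Finite G₁) (fin₂ : Finite G₂) (crit₁ : VertexCritical p G₁) (homogeneous : Homogeneous G₁ S)
  (χS : ChromaticNumber (Induced G₁ S) q) (crit₂ : VertexCritical q G₂) where

  open Substitution G₁ S G₂

  private
    G : Graph
    G = Substitute G₁ S G₂
    E₁ : Enumerable (V G₁)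
    E₁ = Enumerable-↔ (proj₂ fin₁)
    E₂ : Enumerable (V G₂)
    E₂ = Enumerable-↔ (proj₂ fin₂)
    _≟₁_ : DecidableEquality (V G₁)
    _≟₁_ = inj⇒≟ (↔⇒↣ (proj₂ fin₁))
    _≟₂_ : DecidableEquality (V G₂)
    _≟₂_ = inj⇒≟ (↔⇒↣ (proj₂ fin₂))
    χ₁ : ChromaticNumber G₁ p
    χ₁ = proj₁ crit₁
    χ₂ : ChromaticNumber G₂ q
    χ₂ = proj₁ crit₂
    q≤χS : q ≤χ Induced G₁ S
    q≤χS = ChromaticNumber⇒≤χ {H = Induced G₁ S} χS
    ≡true⇒≢false : ∀ {b} → b ≡ true → b ≢ false
    ≡true⇒≢false refl ()

  ChromaticNumber-Substitute : ChromaticNumber G p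
  ChromaticNumber-Substitute =
    Colourable-Substitute⁺ E₁ q≤χS (proj₁ χ₂) (proj₁ χ₁) ,
    λ m m<p → proj₂ χ₁ m m<p ∘
      Colourable-Substitute⁻ homogeneous E₂ (ChromaticNumber⇒≤χ {H = G₂} χ₂) (proj₁ χS)

  Colourable-deleting-outside : (P : V G → Bool) → ∀ a → P (inj₁ a) ≡ false →
                                ∃[ m ] m < p × Colourable (Induced G P) m
  Colourable-deleting-outside P (a₀ , Sa₀) Pa₀ =
    let m , (colourable , _) , m<p = proj₂ crit₁ Q (a₀ , others-self _≟₁_ a₀)
    in m , m<p , Colourable-Induced-Substitute E₁ P Q (λ _ → true) P⇒Q (λ _ _ → refl)
                   q≤χ (Colourable-⇒ (Induced⇒ {H = G₂} _) (proj₁ χ₂)) colourable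
    where
    Q : V G₁ → Bool
    Q = others _≟₁_ a₀
    P⇒Q : ∀ a → P (inj₁ a) ≡ true → Q (proj₁ a) ≡ true
    P⇒Q (a , Sa) Pa = others-≢ _≟₁_ λ { refl →
      ≡true⇒≢false Pa (subst (λ e → P (inj₁ (a₀ , e)) ≡ false)
                             (Decidable⇒UIP.≡-irrelevant Bool._≟_ Sa₀ Sa) Pa₀) }
    keep-S : Induced G₁ S ⇒ Induced (Induced G₁ S) (Q ∘ proj₁)
    keep-S = record { vertex = λ (s , Ss) → (s , Ss) , others-≢ _≟₁_ λ { refl → ≡true⇒≢false Ss Sa₀ }
                    ; edge = λ adj → adj }
    q≤χ : q ≤χ Induced (Induced G₁ S) (Q ∘ proj₁)
    q≤χ m = q≤χS m ∘ Colourable-⇒ keep-S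

  Colourable-deleting-inside : (P : V G → Bool) → ∀ y₀ → P (inj₂ y₀) ≡ false →
                               ∃[ m ] m < p × Colourable (Induced G P) m
  Colourable-deleting-inside P y₀ Py₀
    with proj₂ crit₂ (others _≟₂_ y₀) (y₀ , others-self _≟₂_ y₀) | ∃? E₁ (λ s → S s Bool.≟ true)
  ... | m₂ , (colourable-R , _) , m₂<q | no ¬inhabited =
    contradiction (<-≤-trans m₂<q (q≤χS 0 ((λ s → ⊥-elim (¬inhabited s)) , λ s → ⊥-elim (¬inhabited s))))
                  λ ()
  ... | m₂ , (colourable-R , _) , m₂<q | yes (s₀ , Ss₀) =
    let m , (colourable-Q , _) , m<p = proj₂ crit₁ Q (s₀ , others-self _≟₁_ s₀)
    in m , m<p , Colourable-Induced-Substitute E₁ P Q R P⇒Q P⇒R m₂≤χ colourable-R colourable-Q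
    where
    Q : V G₁ → Bool
    Q = others _≟₁_ s₀
    R : V G₂ → Bool
    R = others _≟₂_ y₀
    P⇒Q : ∀ a → P (inj₁ a) ≡ true → Q (proj₁ a) ≡ true
    P⇒Q (a , Sa) _ = others-≢ _≟₁_ λ { refl → ≡true⇒≢false Ss₀ Sa }
    P⇒R : ∀ y → P (inj₂ y) ≡ true → R y ≡ true
    P⇒R y Py = others-≢ _≟₂_ λ { refl → ≡true⇒≢false Py Py₀ }
    independent : ∀ u v → Q (proj₁ u) ≡ false → Q (proj₁ v) ≡ false → ¬ Adj G₁ (proj₁ u) (proj₁ v)
    independent u v Qu Qv adj = irrefl G₁ (subst₂ (Adj G₁) (others-false _≟₁_ Qu) (others-false _≟₁_ Qv) adj)
    m₂≤χ : m₂ ≤χ Induced (Induced G₁ S) (Q ∘ proj₁)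
    m₂≤χ m colourable =
      ≤-pred (<-≤-trans m₂<q (q≤χS (suc m)
        (Colourable-extendIndependent {H = Induced G₁ S} (Q ∘ proj₁) independent colourable)))

  ChromaticNumber-Induced-Substitute : (P : V G → Bool) → ∃[ v ] P v ≡ false →
                                       ∃[ m ] ChromaticNumber (Induced G P) m × m < p
  ChromaticNumber-Induced-Substitute P deleted =
    let k , k<p , colourable = deleting deleted
        m , χ , m≤k = Colourable⇒ChromaticNumber≤ {H = Induced G P}
                        (Enumerable-subset (Enumerable-Substitute E₁ E₂) P true)
                        (DecNonAdj-Induced {H = G} P nonAdj?) colourable
    in m , χ , ≤-<-trans m≤k k<p
    where
    nonAdj? : DecNonAdj G
    nonAdj? = DecNonAdj-Substitute homogeneous E₁ (VertexCritical⇒DecNonAdj {H = G₁} E₁ _≟₁_ crit₁)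
                                                   (VertexCritical⇒DecNonAdj {H = G₂} E₂ _≟₂_ crit₂)
    deleting : ∃[ v ] P v ≡ false → ∃[ k ] k < p × Colourable (Induced G P) k
    deleting (inj₁ a , Pa) = Colourable-deleting-outside P a Pa
    deleting (inj₂ y , Py) = Colourable-deleting-inside P y Py

lemma8 : (p q : ℕ) (G₁ G₂ : Graph) → Finite G₁ → Finite G₂ →
    VertexCritical p G₁ →
    (S : V G₁ → Bool) → Homogeneous G₁ S → ChromaticNumber (Induced G₁ S) q →
    VertexCritical q G₂ →
    VertexCritical p (Substitute G₁ S G₂)
lemma8 p q G₁ G₂ fin₁ fin₂ crit₁ S homogeneous χS crit₂ =
  ChromaticNumber-Substitute , ChromaticNumber-Induced-Substitute
  where open CriticalSubstitution fin₁ fin₂ crit₁ homogeneous χS crit₂
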